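{- For every $k\ge3$ there exists an infinite family of graphs such that each graph $G$ in the family, with $n$ vertices, satisfies $\mathrm{ctdw}(G)=2k-1$ and has $\left((n-k)/(k-1)\right)^{k-1}$ connected sets $S\subseteq V(G)$ for which $\mathrm{tdw}_S(G)=2k-1$.
   Context: A strong tree decomposition of $G=(V,E)$ is $(\{X_i\}_{i\in I},T=(I,F))$ where $\{X_i\}$ partitions $V$ and $T$ is a tree such that each edge has both ends in one bag or in bags of two adjacent tree nodes; its width is the maximum bag size. A tree distance decomposition is a strong tree decomposition with root $r$ such that each $v\in X_i$, $i\neq r$, has a neighbor in the bag of the parent of $i$. For a vertex set $S$, there is a unique minimal (finest) tree distance decomposition with root bag $S$; $\mathrm{tdw}_S(G)$ is its width, and $\mathrm{tdw}_S(G)=\infty$ if no tree distance decomposition with root bag $S$ exists. A set $S$ is connected if it induces a connected subgraph. $\mathrm{ctdw}(G)$, the root-connected tree distance width, is the minimum width of a tree distance decomposition whose root bag induces a connected subgraph. -}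

module Defs where

open import Data.Nat using (ℕ; zero; suc; _⊔_; _≤_)
open import Data.Bool using (Bool; true; false)
open import Data.Fin using (Fin; _≟_)
open import Data.Fin.Subset using (Subset; _∈_)
open import Data.List using (List; length; filter; map; foldr; allFin)
open import Data.Vec using (tabulate)
open import Data.Product using (Σ; ∃; _×_)
open import Data.Sum using (_⊎_)
open import Relation.Nullary using (¬_)
open import Relation.Nullary.Decidable using (⌊_⌋)
open import Relation.Binary.PropositionalEquality using (_≡_; _≢_)

record Graph (n : ℕ) : Set where
  field
    adj   : Fin n → Fin n → Bool
    sym   : ∀ u v → adj u v ≡ adj v u
    irrfl : ∀ v → adj v v ≡ false

Edge : ∀ {n} → Graph n → Fin n → Fin n → Set
Edge G u v = Graph.adj G u v ≡ true

iter : ∀ {A : Set} → (A → A) → ℕ → A → A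
iter f zero    x = x
iter f (suc k) x = f (iter f k x)

-- The tree T has node set Fin m, is rooted at 'root', and its edges are
-- {i , parent i} for i ≠ root; every node reaches the root by iterating
-- 'parent', so this is exactly a rooted tree.
-- 'bag v' is the tree node whose bag contains v; bags are nonempty, so the
-- bags form a partition of V(G).
record TDD {n : ℕ} (G : Graph n) : Set where
  field
    m       : ℕ
    root    : Fin m
    parent  : Fin m → Fin m
    toRoot  : ∀ i → ∃ λ k → iter parent k i ≡ root
    bag     : Fin n → Fin m
    nonempty : ∀ i → ∃ λ v → bag v ≡ i

  TreeAdj : Fin m → Fin m → Set
  TreeAdj i j = (i ≢ root × parent i ≡ j) ⊎ (j ≢ root × parent j ≡ i)

  field
    edges : ∀ u v → Edge G u v → bag u ≡ bag v ⊎ TreeAdj (bag u) (bag v)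
    dist  : ∀ v → bag v ≢ root → ∃ λ w → Edge G v w × bag w ≡ parent (bag v)

  Bag : Fin m → Subset n
  Bag i = tabulate (λ v → ⌊ bag v ≟ i ⌋)

  rootBag : Subset n
  rootBag = Bag root

  bagSize : Fin m → ℕ
  bagSize i = length (filter (λ v → bag v ≟ i) (allFin n))

  width : ℕ
  width = foldr _⊔_ 0 (map bagSize (allFin m))

data ReachIn {n : ℕ} (G : Graph n) (S : Subset n) : Fin n → Fin n → Set where
  here : ∀ {u} → ReachIn G S u u
  step : ∀ {u w v} → Edge G u w → w ∈ S → ReachIn G S w v → ReachIn G S u v

Connected : ∀ {n} → Graph n → Subset n → Set
Connected G S = ∀ u v → u ∈ S → v ∈ S → ReachIn G S u v

Refines : ∀ {n} {G : Graph n} → TDD G → TDD G → Set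
Refines D D' = ∀ i → ∃ λ j → ∀ v → TDD.bag D v ≡ i → TDD.bag D' v ≡ j

FinestWithRoot : ∀ {n} (G : Graph n) → Subset n → TDD G → Set
FinestWithRoot G S D =
  TDD.rootBag D ≡ S × (∀ (D' : TDD G) → TDD.rootBag D' ≡ S → Refines D D')

TdwIs : ∀ {n} (G : Graph n) → Subset n → ℕ → Set
TdwIs G S w = Σ (TDD G) λ D → FinestWithRoot G S D × TDD.width D ≡ w

CtdwIs : ∀ {n} (G : Graph n) → ℕ → Set
CtdwIs G w =
  (Σ (TDD G) λ D → Connected G (TDD.rootBag D) × TDD.width D ≡ w)
  × (∀ (D : TDD G) → Connected G (TDD.rootBag D) → w ≤ TDD.width D)

-- Take two cliques K, K′ of size w = 2k − 1, a path v₀ … v_{2k−4} with K complete to v₀ and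
-- K′ complete to the last path vertex, and 2k − 2 groups of q pendant leaves at v₀.
-- Choosing one leaf per group gives q^(2k−2) connected sets S = {v₀} ∪ {chosen leaves} of
-- size w, and the finest decomposition rooted at S has the bags S, K, K′ and singletons, so
-- tdw_S = w.  Conversely, every decomposition with connected root bag has width ≥ w: a clique
-- avoiding the root bag lies in a single bag, because true twins outside the root always
-- share a bag; and a connected root bag meeting both cliques contains a walk from K to K′,
-- which meets each of the w levels of the line K, v₀, …, K′.  Since n − k = (k − 1)(2q + 5)
-- and 2q + 5 ≤ q² for q ≥ 4, the count follows.
module Submission where

open import Defs
open import Data.Nat as ℕ using (ℕ; zero; suc; _+_; _*_; _∸_; _^_; _⊔_; _≤_; z≤n; s≤s)
import Data.Nat.Properties as ℕ
open import Data.Nat.Tactic.RingSolver using (solve-∀)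
open import Data.Fin as Fin using (Fin; zero; suc; toℕ; fromℕ; inject₁; punchIn; punchOut; _≟_)
import Data.Fin.Properties as Fin
open import Data.Fin.Subset using (Subset; _∈_)
open import Data.List using (List; []; _∷_; length; filter; map; foldr; allFin; lookup; tabulate)
import Data.List.Properties as List
open import Data.List.Membership.Propositional using () renaming (_∈_ to _∈ₗ_)
open import Data.List.Membership.Propositional.Properties
  using (∈-lookup; ∈-allFin; ∈-filter⁺; ∈-filter⁻; ∈-map⁺; ∈-map⁻)
open import Data.List.Relation.Binary.Subset.Propositional using (_⊆_)
open import Data.List.Relation.Unary.All as All using (All)
import Data.List.Relation.Unary.All.Properties as All
open import Data.List.Relation.Unary.Any as Any using (here; there)
open import Data.List.Relation.Unary.Any.Properties using (lookup-index)
open import Data.List.Relation.Unary.AllPairs using (_∷_)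
open import Data.List.Relation.Unary.Unique.Propositional using (Unique)
import Data.List.Relation.Unary.Unique.Propositional.Properties as Unique
import Data.Vec.Properties as Vec
open import Data.Product using (Σ; ∃; _×_; _,_; proj₁; proj₂; uncurry; map₂)
open import Data.Product.Function.NonDependent.Propositional using (_×-↔_)
open import Data.Sum using (_⊎_; inj₁; inj₂)
open import Data.Sum.Function.Propositional using (_⊎-↔_)
open import Data.Unit using (⊤; tt)
open import Data.Bool using (true; false)
open import Data.Empty using (⊥; ⊥-elim)
open import Function using (Injective; _∘_; id; _↔_; Inverse; mk⇔; mk↔ₛ′)
open import Function.Properties.Inverse using (↔-refl; ↔-sym; ↔-trans)
open import Relation.Nullary using (¬_; Dec; yes; no; _⊎-dec_)
open import Relation.Nullary.Decidable using (⌊_⌋; isYes≗does; does-⇔; dec-false)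
open import Relation.Binary.PropositionalEquality

⌊⌋≡true⁺ : ∀ {A : Set} (a? : Dec A) → A → ⌊ a? ⌋ ≡ true
⌊⌋≡true⁺ (yes _) _ = refl
⌊⌋≡true⁺ (no ¬a) a = ⊥-elim (¬a a)

⌊⌋≡true⁻ : ∀ {A : Set} (a? : Dec A) → ⌊ a? ⌋ ≡ true → A
⌊⌋≡true⁻ (yes a) _ = a

lookup-injective : ∀ {A : Set} {xs : List A} → Unique xs →
  Injective _≡_ _≡_ (lookup xs)
lookup-injective {xs = x ∷ xs} (x∉xs ∷ u) {zero}  {zero}  _  = refl
lookup-injective {xs = x ∷ xs} (x∉xs ∷ u) {zero}  {suc j} eq =
  ⊥-elim (All.lookup x∉xs (∈-lookup j) eq)
lookup-injective {xs = x ∷ xs} (x∉xs ∷ u) {suc i} {zero}  eq =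
  ⊥-elim (All.lookup x∉xs (∈-lookup i) (sym eq))
lookup-injective {xs = x ∷ xs} (x∉xs ∷ u) {suc i} {suc j} eq =
  cong suc (lookup-injective u eq)

Unique-⊆⇒length≤ : ∀ {A : Set} {xs ys : List A} → Unique xs → xs ⊆ ys →
  length xs ≤ length ys
Unique-⊆⇒length≤ {xs = xs} {ys} u xs⊆ys = Fin.injective⇒≤ position-injective
  where
  position : Fin (length xs) → Fin (length ys)
  position i = Any.index (xs⊆ys (∈-lookup i))

  position-injective : Injective _≡_ _≡_ position
  position-injective {i} {j} eq = lookup-injective u (begin
    lookup xs i           ≡⟨ lookup-index (xs⊆ys (∈-lookup i)) ⟩
    lookup ys (position i) ≡⟨ cong (lookup ys) eq ⟩
    lookup ys (position j) ≡⟨ lookup-index (xs⊆ys (∈-lookup j)) ⟨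
    lookup xs j           ∎)
    where open ≡-Reasoning

length-map-allFin : ∀ {A : Set} {n} (f : Fin n → A) → length (map f (allFin n)) ≡ n
length-map-allFin {n = n} f = trans (List.length-map f (allFin n)) (List.length-tabulate id)

iter-suc : ∀ {A : Set} (f : A → A) k x → iter f (suc k) x ≡ iter f k (f x)
iter-suc f zero    x = refl
iter-suc f (suc k) x = cong f (iter-suc f k x)

digits : ∀ {q} k → Fin (q ^ k) → Fin k → Fin q
digits {q} (suc k) i zero    = proj₁ (Fin.remQuot {q} (q ^ k) i)
digits {q} (suc k) i (suc j) = digits k (proj₂ (Fin.remQuot {q} (q ^ k) i)) j

digits-injective : ∀ {q} k {i i′ : Fin (q ^ k)} →
  (∀ j → digits k i j ≡ digits k i′ j) → i ≡ i′
digits-injective zero {zero} {zero} _ = refl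
digits-injective {q} (suc k) {i} {i′} same = begin
  i                                                   ≡⟨ Fin.combine-remQuot {q} (q ^ k) i ⟨
  uncurry (Fin.combine {q}) (Fin.remQuot (q ^ k) i)
    ≡⟨ cong₂ (Fin.combine {q}) (same zero) (digits-injective k (same ∘ suc)) ⟩
  uncurry (Fin.combine {q}) (Fin.remQuot (q ^ k) i′)  ≡⟨ Fin.combine-remQuot {q} (q ^ k) i′ ⟩
  i′                                                  ∎
  where open ≡-Reasoning

*-^-distrib : ∀ a b e → (a * b) ^ e ≡ a ^ e * b ^ e
*-^-distrib a b zero    = refl
*-^-distrib a b (suc e) =
  trans (cong ((a * b) *_) (*-^-distrib a b e)) (interchange a b (a ^ e) (b ^ e))
  where
  interchange : ∀ a b x y → (a * b) * (x * y) ≡ (a * x) * (b * y)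
  interchange = solve-∀

*-^-≤ : ∀ {X Y} r e → X ≤ Y → (r * X) ^ e ≤ Y ^ e * r ^ e
*-^-≤ {X} {Y} r e X≤Y = begin
  (r * X) ^ e     ≡⟨ *-^-distrib r X e ⟩
  r ^ e * X ^ e   ≤⟨ ℕ.*-monoʳ-≤ (r ^ e) (ℕ.^-monoˡ-≤ e X≤Y) ⟩
  r ^ e * Y ^ e   ≡⟨ ℕ.*-comm (r ^ e) (Y ^ e) ⟩
  Y ^ e * r ^ e   ∎
  where open ℕ.≤-Reasoning

*-^-≤-square : ∀ {X q} r → X ≤ q * q → (r * X) ^ r ≤ q ^ (r + r) * r ^ r
*-^-≤-square {X} {q} r X≤q² = begin
  (r * X) ^ r            ≤⟨ *-^-≤ r r X≤q² ⟩
  (q * q) ^ r * r ^ r    ≡⟨ cong (_* r ^ r) (*-^-distrib q q r) ⟩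
  q ^ r * q ^ r * r ^ r  ≡⟨ cong (_* r ^ r) (ℕ.^-distribˡ-+-* q r r) ⟨
  q ^ (r + r) * r ^ r    ∎
  where open ℕ.≤-Reasoning

maximum : List ℕ → ℕ
maximum = foldr _⊔_ 0

≤-maximum : ∀ {x xs} → x ∈ₗ xs → x ≤ maximum xs
≤-maximum {xs = y ∷ ys} (here refl) = ℕ.m≤m⊔n y _
≤-maximum {xs = y ∷ ys} (there x∈) = ℕ.≤-trans (≤-maximum x∈) (ℕ.m≤n⊔m y _)

maximum-lub : ∀ {b} xs → (∀ {x} → x ∈ₗ xs → x ≤ b) → maximum xs ≤ b
maximum-lub []       _  = z≤n
maximum-lub (y ∷ ys) ub = ℕ.⊔-lub (ub (here refl)) (maximum-lub ys (ub ∘ there))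

module TDDProperties {n : ℕ} {G : Graph n} (D : TDD G) where
  open TDD D

  ∈-Bag⁺ : ∀ {v i} → bag v ≡ i → v ∈ Bag i
  ∈-Bag⁺ {v} {i} eq =
    Vec.lookup⇒[]= v (Bag i) (trans (Vec.lookup∘tabulate _ v) (⌊⌋≡true⁺ (bag v ≟ i) eq))

  ∈-Bag⁻ : ∀ {v i} → v ∈ Bag i → bag v ≡ i
  ∈-Bag⁻ {v} {i} v∈ =
    ⌊⌋≡true⁻ (bag v ≟ i) (trans (sym (Vec.lookup∘tabulate _ v)) (Vec.[]=⇒lookup v∈))

  injection⇒≤bagSize : ∀ {a b} (f : Fin a → Fin n) → Injective _≡_ _≡_ f →
    (∀ i → bag (f i) ≡ b) → a ≤ bagSize b
  injection⇒≤bagSize {a} {b} f f-inj f∈b =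
    subst (_≤ bagSize b) (length-map-allFin f)
      (Unique-⊆⇒length≤ (Unique.map⁺ f-inj (Unique.allFin⁺ a)) image⊆bag)
    where
    image⊆bag : map f (allFin a) ⊆ filter (λ v → bag v ≟ b) (allFin n)
    image⊆bag v∈ with ∈-map⁻ f v∈
    ... | i , _ , refl = ∈-filter⁺ (λ v → bag v ≟ b) (∈-allFin (f i)) (f∈b i)

  bag⊆⇒bagSize≤ : ∀ b (vs : List (Fin n)) → (∀ v → bag v ≡ b → v ∈ₗ vs) →
    bagSize b ≤ length vs
  bag⊆⇒bagSize≤ b vs bag⊆vs =
    Unique-⊆⇒length≤ (Unique.filter⁺ (λ v → bag v ≟ b) (Unique.allFin⁺ n))
      (λ v∈ → bag⊆vs _ (proj₂ (∈-filter⁻ (λ v → bag v ≟ b) {xs = allFin n} v∈)))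

  bagSize≤width : ∀ b → bagSize b ≤ width
  bagSize≤width b = ≤-maximum (∈-map⁺ bagSize (∈-allFin b))

  width-lub : ∀ {c} → (∀ b → bagSize b ≤ c) → width ≤ c
  width-lub {c} ub = maximum-lub (map bagSize (allFin m)) bounded
    where
    bounded : ∀ {x} → x ∈ₗ map bagSize (allFin m) → x ≤ c
    bounded x∈ with ∈-map⁻ bagSize x∈
    ... | b , _ , refl = ub b

  parent-closed⇒root : (P : Fin m → Set) → (∀ i → P i → P (parent i)) →
    ∀ i → P i → ∃ λ j → P j × j ≡ root
  parent-closed⇒root P closed i Pi with toRoot i
  ... | k , reaches = iter parent k i , iterate k , reaches
    where
    iterate : ∀ k → P (iter parent k i)
    iterate zero    = Pi
    iterate (suc k) = closed _ (iterate k)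

  no-parent-1cycle : ∀ {a} → parent a ≡ a → a ≢ root → ⊥
  no-parent-1cycle {a} pa a≢r with parent-closed⇒root (_≡ a) (λ { _ refl → pa }) a refl
  ... | _ , refl , j≡r = a≢r j≡r

  no-parent-2cycle : ∀ {a b} → parent a ≡ b → parent b ≡ a → a ≢ root → b ≢ root → ⊥
  no-parent-2cycle {a} {b} pa pb a≢r b≢r
    with parent-closed⇒root (λ i → i ≡ a ⊎ i ≡ b)
           (λ { _ (inj₁ refl) → inj₂ pa ; _ (inj₂ refl) → inj₁ pb }) a (inj₁ refl)
  ... | _ , inj₁ refl , j≡r = a≢r j≡r
  ... | _ , inj₂ refl , j≡r = b≢r j≡r

  no-parent-3cycle : ∀ {a b c} → parent a ≡ b → parent b ≡ c → parent c ≡ a →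
    a ≢ root → b ≢ root → c ≢ root → ⊥
  no-parent-3cycle {a} {b} {c} pa pb pc a≢r b≢r c≢r
    with parent-closed⇒root (λ i → i ≡ a ⊎ i ≡ b ⊎ i ≡ c)
           (λ { _ (inj₁ refl) → inj₂ (inj₁ pa) ; _ (inj₂ (inj₁ refl)) → inj₂ (inj₂ pb)
              ; _ (inj₂ (inj₂ refl)) → inj₁ pc }) a (inj₁ refl)
  ... | _ , inj₁ refl , j≡r        = a≢r j≡r
  ... | _ , inj₂ (inj₁ refl) , j≡r = b≢r j≡r
  ... | _ , inj₂ (inj₂ refl) , j≡r = c≢r j≡r

  -- The neighbour w of v in the parent of bag v is, unless w = u, also a neighbour of u;
  -- either way it closes a parent-cycle of length 1, 2 or 3 through the bags of u and v.
  twin-not-child : ∀ u v → (∀ w → Edge G v w → w ≢ u → Edge G u w) →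
    bag u ≢ root → bag v ≢ root → parent (bag u) ≢ bag v
  twin-not-child u v twin u∉r v∉r pu with dist v v∉r
  ... | w , vw , bw with w ≟ u
  ...   | yes refl = no-parent-2cycle pu (sym bw) u∉r v∉r
  ...   | no w≢u with edges u w (twin w vw w≢u)
  ...     | inj₁ bu≡bw                = no-parent-2cycle pu (sym (trans bu≡bw bw)) u∉r v∉r
  ...     | inj₂ (inj₁ (_ , pu≡bw))   = no-parent-1cycle (trans (sym bw) (trans (sym pu≡bw) pu)) v∉r
  ...     | inj₂ (inj₂ (w∉r , pw≡bu)) = no-parent-3cycle pu (sym bw) pw≡bu u∉r v∉r w∉r

  true-twins-share-bag : ∀ u v → Edge G u v →
    (∀ w → Edge G v w → w ≢ u → Edge G u w) → (∀ w → Edge G u w → w ≢ v → Edge G v w) →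
    bag u ≢ root → bag v ≢ root → bag u ≡ bag v
  true-twins-share-bag u v uv twinᵘ twinᵛ u∉r v∉r with edges u v uv
  ... | inj₁ same              = same
  ... | inj₂ (inj₁ (_ , pu))   = ⊥-elim (twin-not-child u v twinᵘ u∉r v∉r pu)
  ... | inj₂ (inj₂ (_ , pv))   = ⊥-elim (twin-not-child v u twinᵛ v∉r u∉r pv)

rootBag-≡⇒∈root : ∀ {n} {G : Graph n} (D D′ : TDD G) → TDD.rootBag D ≡ TDD.rootBag D′ →
  ∀ {v} → TDD.bag D v ≡ TDD.root D → TDD.bag D′ v ≡ TDD.root D′
rootBag-≡⇒∈root D D′ same v∈r =
  TDDProperties.∈-Bag⁻ D′ (subst (_ ∈_) same (TDDProperties.∈-Bag⁺ D v∈r))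

module _ {n : ℕ} (G : Graph n) where

  Edge-sym : ∀ {u v} → Edge G u v → Edge G v u
  Edge-sym {u} {v} uv = trans (Graph.sym G v u) uv

  ReachIn-trans : ∀ {S u v w} → ReachIn G S u v → ReachIn G S v w → ReachIn G S u w
  ReachIn-trans here             r = r
  ReachIn-trans (step uw w∈S rw) r = step uw w∈S (ReachIn-trans rw r)

  star⇒connected : ∀ {S c} → c ∈ S → (∀ v → v ∈ S → v ≡ c ⊎ Edge G v c) → Connected G S
  star⇒connected {S} {c} c∈S spoke u v u∈S v∈S =
    ReachIn-trans (toCentre (spoke u u∈S)) (fromCentre (spoke v v∈S))
    where
    toCentre : u ≡ c ⊎ Edge G u c → ReachIn G S u c
    toCentre (inj₁ refl) = here
    toCentre (inj₂ uc)   = step uc c∈S here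

    fromCentre : v ≡ c ⊎ Edge G v c → ReachIn G S c v
    fromCentre (inj₁ refl) = here
    fromCentre (inj₂ vc)   = step (Edge-sym vc) v∈S here

  walk-crosses-levels : (level : Fin n → ℕ) →
    (∀ {u v} → Edge G u v → level v ≤ suc (level u)) →
    ∀ {S u v} → ReachIn G S u v → u ∈ S →
    ∀ j → level u ≤ j → j ≤ level v → ∃ λ w → w ∈ S × level w ≡ j
  walk-crosses-levels level step≤ {u = u} here u∈S j lu≤j j≤lv = u , u∈S , ℕ.≤-antisym lu≤j j≤lv
  walk-crosses-levels level step≤ {u = u} (step uw w∈S rw) u∈S j lu≤j j≤lv with j ℕ.≤? level u
  ... | yes j≤lu = u , u∈S , ℕ.≤-antisym lu≤j j≤lu
  ... | no  j≰lu = walk-crosses-levels level step≤ rw w∈S j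
                     (ℕ.≤-trans (step≤ uw) (ℕ.≰⇒> j≰lu)) j≤lv

Linked : ∀ {Node : Set} → Node → (Node → Node) → Node → Node → Set
Linked root parent a b = a ≡ b ⊎ (a ≢ root × parent a ≡ b) ⊎ (b ≢ root × parent b ≡ a)

Linked-sym : ∀ {Node : Set} {root : Node} {parent a b} →
  Linked root parent a b → Linked root parent b a
Linked-sym (inj₁ refl)      = inj₁ refl
Linked-sym (inj₂ (inj₁ ab)) = inj₂ (inj₂ ab)
Linked-sym (inj₂ (inj₂ ba)) = inj₂ (inj₁ ba)

module EncodedGraph {V : Set} {n : ℕ} (vertexCode : V ↔ Fin n)
  (Adj : V → V → Set) (adj? : ∀ x y → Dec (Adj x y))
  (Adj-sym : ∀ {x y} → Adj x y → Adj y x) (Adj-irrefl : ∀ {x} → ¬ Adj x x) where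

  open Inverse vertexCode public
    using () renaming (to to vtx; from to vtx⁻¹; strictlyInverseˡ to vtx∘vtx⁻¹;
                       strictlyInverseʳ to vtx⁻¹∘vtx)

  adj?-sym : ∀ x y → ⌊ adj? x y ⌋ ≡ ⌊ adj? y x ⌋
  adj?-sym x y = trans (isYes≗does (adj? x y))
    (trans (does-⇔ (mk⇔ Adj-sym Adj-sym) (adj? x y) (adj? y x)) (sym (isYes≗does (adj? y x))))

  adj?-irrefl : ∀ x → ⌊ adj? x x ⌋ ≡ false
  adj?-irrefl x = trans (isYes≗does (adj? x x)) (dec-false (adj? x x) Adj-irrefl)

  graph : Graph n
  graph = record
    { adj   = λ u v → ⌊ adj? (vtx⁻¹ u) (vtx⁻¹ v) ⌋
    ; sym   = λ u v → adj?-sym (vtx⁻¹ u) (vtx⁻¹ v)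
    ; irrfl = λ v → adj?-irrefl (vtx⁻¹ v)
    }

  Edge⇒Adj : ∀ {u v} → Edge graph u v → Adj (vtx⁻¹ u) (vtx⁻¹ v)
  Edge⇒Adj = ⌊⌋≡true⁻ (adj? _ _)

  Adj⇒Edge : ∀ {x y} → Adj x y → Edge graph (vtx x) (vtx y)
  Adj⇒Edge {x} {y} xy =
    ⌊⌋≡true⁺ (adj? _ _) (subst₂ Adj (sym (vtx⁻¹∘vtx x)) (sym (vtx⁻¹∘vtx y)) xy)

  vtx-injective : ∀ {x y} → vtx x ≡ vtx y → x ≡ y
  vtx-injective {x} {y} eq = trans (sym (vtx⁻¹∘vtx x)) (trans (cong vtx⁻¹ eq) (vtx⁻¹∘vtx y))

  twin⇒Edge-twin : ∀ {x y} → (∀ {z} → Adj y z → z ≢ x → Adj x z) →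
    ∀ w → Edge graph (vtx y) w → w ≢ vtx x → Edge graph (vtx x) w
  twin⇒Edge-twin {x} {y} twin w yw w≢x =
    subst (Edge graph (vtx x)) (vtx∘vtx⁻¹ w)
      (Adj⇒Edge (twin (subst (λ z → Adj z (vtx⁻¹ w)) (vtx⁻¹∘vtx y) (Edge⇒Adj yw))
                      (λ w≡x → w≢x (trans (sym (vtx∘vtx⁻¹ w)) (cong vtx w≡x)))))

  record Decomposition (Node : Set) : Set where
    field
      root       : Node
      parent     : Node → Node
      toRoot     : ∀ x → ∃ λ k → iter parent k x ≡ root
      bag        : V → Node
      member     : Node → V
      bag-member : ∀ x → bag (member x) ≡ x
      edges      : ∀ {x y} → Adj x y → Linked root parent (bag x) (bag y)
      dist       : ∀ x → bag x ≢ root → ∃ λ y → Adj x y × bag y ≡ parent (bag x)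

  module Encode {Node : Set} {m : ℕ} (nodeCode : Node ↔ Fin m) (D : Decomposition Node) where
    open Decomposition D
    open Inverse nodeCode
      using () renaming (to to nd; from to nd⁻¹; strictlyInverseˡ to nd∘nd⁻¹;
                         strictlyInverseʳ to nd⁻¹∘nd)

    nd-injective : ∀ {a b} → nd a ≡ nd b → a ≡ b
    nd-injective {a} {b} eq = trans (sym (nd⁻¹∘nd a)) (trans (cong nd⁻¹ eq) (nd⁻¹∘nd b))

    parentᶠ : Fin m → Fin m
    parentᶠ i = nd (parent (nd⁻¹ i))

    iter-parentᶠ : ∀ k x → iter parentᶠ k (nd x) ≡ nd (iter parent k x)
    iter-parentᶠ zero    x = refl
    iter-parentᶠ (suc k) x =
      trans (cong parentᶠ (iter-parentᶠ k x)) (cong (nd ∘ parent) (nd⁻¹∘nd _))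

    Linked⇒TreeAdj : ∀ {a b} → Linked root parent a b →
      nd a ≡ nd b ⊎ (nd a ≢ nd root × parentᶠ (nd a) ≡ nd b)
                  ⊎ (nd b ≢ nd root × parentᶠ (nd b) ≡ nd a)
    Linked⇒TreeAdj (inj₁ refl) = inj₁ refl
    Linked⇒TreeAdj {a} (inj₂ (inj₁ (a≢r , pa))) =
      inj₂ (inj₁ (a≢r ∘ nd-injective , cong nd (trans (cong parent (nd⁻¹∘nd a)) pa)))
    Linked⇒TreeAdj {b = b} (inj₂ (inj₂ (b≢r , pb))) =
      inj₂ (inj₂ (b≢r ∘ nd-injective , cong nd (trans (cong parent (nd⁻¹∘nd b)) pb)))

    tdd : TDD graph
    tdd = record
      { m        = m
      ; root     = nd root
      ; parent   = parentᶠ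
      ; toRoot   = λ i → let k , reaches = toRoot (nd⁻¹ i) in
                   k , trans (cong (iter parentᶠ k) (sym (nd∘nd⁻¹ i)))
                         (trans (iter-parentᶠ k (nd⁻¹ i)) (cong nd reaches))
      ; bag      = λ u → nd (bag (vtx⁻¹ u))
      ; nonempty = λ i → vtx (member (nd⁻¹ i)) ,
                   trans (cong (nd ∘ bag) (vtx⁻¹∘vtx _))
                     (trans (cong nd (bag-member (nd⁻¹ i))) (nd∘nd⁻¹ i))
      ; edges    = λ u v uv → Linked⇒TreeAdj (edges (Edge⇒Adj uv))
      ; dist     = distᶠ
      }
      where
      distᶠ : ∀ u → nd (bag (vtx⁻¹ u)) ≢ nd root →
        ∃ λ w → Edge graph u w × nd (bag (vtx⁻¹ w)) ≡ parentᶠ (nd (bag (vtx⁻¹ u)))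
      distᶠ u u∉r with dist (vtx⁻¹ u) (u∉r ∘ cong nd)
      ... | y , xy , by =
        vtx y , ⌊⌋≡true⁺ (adj? _ _) (subst (Adj (vtx⁻¹ u)) (sym (vtx⁻¹∘vtx y)) xy) ,
        trans (cong (nd ∘ bag) (vtx⁻¹∘vtx y))
          (trans (cong nd by) (cong (nd ∘ parent) (sym (nd⁻¹∘nd _))))

    open TDDProperties tdd using (bag⊆⇒bagSize≤; width-lub)

    tdd-bag : ∀ x → TDD.bag tdd (vtx x) ≡ nd (bag x)
    tdd-bag x = cong (nd ∘ bag) (vtx⁻¹∘vtx x)

    tdd-bag-root⁺ : ∀ {x} → bag x ≡ root → TDD.bag tdd (vtx x) ≡ TDD.root tdd
    tdd-bag-root⁺ {x} x∈r = trans (tdd-bag x) (cong nd x∈r)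

    tdd-bag-root⁻ : ∀ {x} → TDD.bag tdd (vtx x) ≡ TDD.root tdd → bag x ≡ root
    tdd-bag-root⁻ {x} x∈r = nd-injective (trans (sym (tdd-bag x)) x∈r)

    width≤ : ∀ {c} (members : Node → List V) → (∀ x → x ∈ₗ members (bag x)) →
      (∀ a → length (members a) ≤ c) → TDD.width tdd ≤ c
    width≤ {c} members covers small = width-lub λ b →
      ℕ.≤-trans (bag⊆⇒bagSize≤ b (map vtx (members (nd⁻¹ b))) (inBag b))
        (ℕ.≤-trans (ℕ.≤-reflexive (List.length-map vtx (members (nd⁻¹ b)))) (small (nd⁻¹ b)))
      where
      inBag : ∀ b u → nd (bag (vtx⁻¹ u)) ≡ b → u ∈ₗ map vtx (members (nd⁻¹ b))
      inBag _ u refl rewrite nd⁻¹∘nd (bag (vtx⁻¹ u)) =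
        subst (_∈ₗ map vtx (members (bag (vtx⁻¹ u)))) (vtx∘vtx⁻¹ u)
          (∈-map⁺ vtx (covers (vtx⁻¹ u)))

    refines : (D′ : TDD graph) →
      (∀ {x y} → bag x ≡ bag y → TDD.bag D′ (vtx x) ≡ TDD.bag D′ (vtx y)) → Refines tdd D′
    refines D′ cohere i = TDD.bag D′ (vtx (member (nd⁻¹ i))) , λ u u∈i →
      trans (cong (TDD.bag D′) (sym (vtx∘vtx⁻¹ u)))
        (cohere (trans (sym (nd⁻¹∘nd _)) (trans (cong nd⁻¹ u∈i) (sym (bag-member _)))))

module Construction (p q′ : ℕ) where

  w groups q : ℕ
  w      = 3 + p
  groups = 2 + p
  q      = suc q′

  data Side : Set where
    left right : Side

  _≟ˢ_ : (s t : Side) → Dec (s ≡ t)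
  left  ≟ˢ left  = yes refl
  right ≟ˢ right = yes refl
  left  ≟ˢ right = no λ ()
  right ≟ˢ left  = no λ ()

  sideCode : Fin 2 ↔ Side
  sideCode = mk↔ₛ′ (λ { zero → left ; (suc zero) → right }) (λ { left → zero ; right → suc zero })
    (λ { left → refl ; right → refl }) (λ { zero → refl ; (suc zero) → refl })

  end : Side → Fin (suc p)
  end left  = zero
  end right = fromℕ p

  data Vertex : Set where
    clique : Side → Fin w → Vertex
    path   : Fin (suc p) → Vertex
    leaf   : Fin groups → Fin q → Vertex

  data Arc : Vertex → Vertex → Set where
    clique-clique : ∀ {s i j} → i ≢ j → Arc (clique s i) (clique s j)
    clique-path   : ∀ {s i} → Arc (clique s i) (path (end s))
    path-path     : ∀ {i} → Arc (path (inject₁ i)) (path (suc i))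
    leaf-path     : ∀ {g l} → Arc (leaf g l) (path zero)

  Adj : Vertex → Vertex → Set
  Adj x y = Arc x y ⊎ Arc y x

  arc? : ∀ x y → Dec (Arc x y)
  arc? (clique s i) (clique t j) with s ≟ˢ t | i ≟ j
  ... | no s≢t   | _        = no λ { (clique-clique _) → s≢t refl }
  ... | yes refl | yes refl = no λ { (clique-clique i≢i) → i≢i refl }
  ... | yes refl | no i≢j   = yes (clique-clique i≢j)
  arc? (clique s i) (path j) with j ≟ end s
  ... | yes refl = yes clique-path
  ... | no j≢end = no λ { clique-path → j≢end refl }
  arc? (path i) (path zero) = no λ ()
  arc? (path i) (path (suc j)) with i ≟ inject₁ j
  ... | yes refl = yes path-path
  ... | no i≢j   = no λ { path-path → i≢j refl }
  arc? (leaf g l) (path zero)    = yes leaf-path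
  arc? (leaf g l) (path (suc j)) = no λ ()
  arc? (clique _ _) (leaf _ _)   = no λ ()
  arc? (path _) (clique _ _)     = no λ ()
  arc? (path _) (leaf _ _)       = no λ ()
  arc? (leaf _ _) (clique _ _)   = no λ ()
  arc? (leaf _ _) (leaf _ _)     = no λ ()

  adj? : ∀ x y → Dec (Adj x y)
  adj? x y = arc? x y ⊎-dec arc? y x

  level : Vertex → ℕ
  level (clique left _)  = 0
  level (clique right _) = suc (suc p)
  level (path i)         = suc (toℕ i)
  level (leaf _ _)       = 1

  arc-level : ∀ {x y} → Arc x y → level y ≤ suc (level x) × level x ≤ suc (level y)
  arc-level (clique-clique {left} _)  = z≤n , z≤n
  arc-level (clique-clique {right} _) = ℕ.n≤1+n _ , ℕ.n≤1+n _
  arc-level (clique-path {left})      = s≤s z≤n , z≤n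
  arc-level (clique-path {right}) rewrite Fin.toℕ-fromℕ p = ℕ.m≤n+m _ 2 , ℕ.≤-refl
  arc-level (path-path {i})       rewrite Fin.toℕ-inject₁ i = ℕ.≤-refl , ℕ.m≤n+m _ 2
  arc-level leaf-path                 = ℕ.n≤1+n _ , ℕ.n≤1+n _

  Adj-level : ∀ {x y} → Adj x y → level y ≤ suc (level x)
  Adj-level (inj₁ xy) = proj₁ (arc-level xy)
  Adj-level (inj₂ yx) = proj₂ (arc-level yx)

  Arc⇒≢ : ∀ {x y} → Arc x y → x ≢ y
  Arc⇒≢ (clique-clique i≢j) refl = i≢j refl
  Arc⇒≢ (path-path {i}) eq =
    ℕ.1+n≢n (trans (sym (ℕ.suc-injective (cong level eq))) (Fin.toℕ-inject₁ i))

  Adj-sym : ∀ {x y} → Adj x y → Adj y x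
  Adj-sym (inj₁ xy) = inj₂ xy
  Adj-sym (inj₂ yx) = inj₁ yx

  Adj-irrefl : ∀ {x} → ¬ Adj x x
  Adj-irrefl (inj₁ xx) = Arc⇒≢ xx refl
  Adj-irrefl (inj₂ xx) = Arc⇒≢ xx refl

  n : ℕ
  n = 2 * w + (suc p + groups * q)

  opaque
    vertexCode : Vertex ↔ Fin n
    vertexCode = ↔-trans asSum (↔-sym (↔-trans Fin.+↔⊎
      (↔-trans Fin.*↔× (sideCode ×-↔ ↔-refl) ⊎-↔ ↔-trans Fin.+↔⊎ (↔-refl ⊎-↔ Fin.*↔×))))
      where
      asSum : Vertex ↔ ((Side × Fin w) ⊎ (Fin (suc p) ⊎ (Fin groups × Fin q)))
      asSum = mk↔ₛ′
        (λ { (clique s i) → inj₁ (s , i) ; (path i) → inj₂ (inj₁ i)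
           ; (leaf g l) → inj₂ (inj₂ (g , l)) })
        (λ { (inj₁ (s , i)) → clique s i ; (inj₂ (inj₁ i)) → path i
           ; (inj₂ (inj₂ (g , l))) → leaf g l })
        (λ { (inj₁ _) → refl ; (inj₂ (inj₁ _)) → refl ; (inj₂ (inj₂ _)) → refl })
        (λ { (clique _ _) → refl ; (path _) → refl ; (leaf _ _) → refl })

  open EncodedGraph vertexCode Adj adj? Adj-sym Adj-irrefl public

  clique-twin : ∀ {s i j y} → Adj (clique s j) y → y ≢ clique s i → Adj (clique s i) y
  clique-twin (inj₁ (clique-clique _)) y≢i = inj₁ (clique-clique λ { refl → y≢i refl })
  clique-twin (inj₁ clique-path)       _   = inj₁ clique-path
  clique-twin (inj₂ (clique-clique _)) y≢i = inj₂ (clique-clique λ { refl → y≢i refl })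

  clique-injective : ∀ {s i j} → vtx (clique s i) ≡ vtx (clique s j) → i ≡ j
  clique-injective {s} {i} {j} eq with vtx-injective {clique s i} {clique s j} eq
  ... | refl = refl

  module AnyDecomposition (D : TDD graph) where
    open TDD D
    open TDDProperties D

    clique-bag≡ : ∀ s → (∀ i → bag (vtx (clique s i)) ≢ root) →
      ∀ i → bag (vtx (clique s i)) ≡ bag (vtx (clique s zero))
    clique-bag≡ s outside i with i ≟ zero
    ... | yes refl = refl
    ... | no i≢0   = true-twins-share-bag (vtx (clique s i)) (vtx (clique s zero))
                       (Adj⇒Edge (inj₁ (clique-clique i≢0)))
                       (twin⇒Edge-twin {clique s i} {clique s zero} clique-twin)
                       (twin⇒Edge-twin {clique s zero} {clique s i} clique-twin)
                       (outside i) (outside zero)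

    clique-outside-root : ∀ s → (∀ i → bag (vtx (clique s i)) ≢ root) → w ≤ width
    clique-outside-root s outside =
      ℕ.≤-trans (injection⇒≤bagSize (vtx ∘ clique s) clique-injective (clique-bag≡ s outside))
                (bagSize≤width _)

    -- a walk inside the root bag from the left to the right clique meets all w levels
    root-spans-levels : Connected graph rootBag → ∀ {i j} →
      bag (vtx (clique left i)) ≡ root → bag (vtx (clique right j)) ≡ root → w ≤ width
    root-spans-levels conn {i} {j} i∈r j∈r =
      ℕ.≤-trans (injection⇒≤bagSize atLevel atLevel-injective (∈-Bag⁻ ∘ proj₁ ∘ proj₂ ∘ hit))
                (bagSize≤width root)
      where
      walk : ReachIn graph rootBag (vtx (clique left i)) (vtx (clique right j))
      walk = conn _ _ (∈-Bag⁺ i∈r) (∈-Bag⁺ j∈r)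

      level≡ : ∀ x → level (vtx⁻¹ (vtx x)) ≡ level x
      level≡ x = cong level (vtx⁻¹∘vtx x)

      hit : ∀ (l : Fin w) → ∃ λ u → u ∈ rootBag × level (vtx⁻¹ u) ≡ toℕ l
      hit l = walk-crosses-levels graph (level ∘ vtx⁻¹) (Adj-level ∘ Edge⇒Adj)
        walk (∈-Bag⁺ i∈r) (toℕ l) (subst (_≤ toℕ l) (sym (level≡ (clique left i))) z≤n)
        (subst (toℕ l ≤_) (sym (level≡ (clique right j))) (ℕ.≤-pred (Fin.toℕ<n l)))

      atLevel : Fin w → Fin n
      atLevel l = proj₁ (hit l)

      atLevel-injective : ∀ {l l′} → atLevel l ≡ atLevel l′ → l ≡ l′
      atLevel-injective {l} {l′} eq = Fin.toℕ-injective (trans (sym (proj₂ (proj₂ (hit l))))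
        (trans (cong (level ∘ vtx⁻¹) eq) (proj₂ (proj₂ (hit l′)))))

    width-lower : Connected graph rootBag → w ≤ width
    width-lower conn with Fin.any? (λ i → bag (vtx (clique left i)) ≟ root)
                        | Fin.any? (λ j → bag (vtx (clique right j)) ≟ root)
    ... | yes (i , i∈r) | yes (j , j∈r) = root-spans-levels conn i∈r j∈r
    ... | no ∉r         | _             = clique-outside-root left λ i i∈r → ∉r (i , i∈r)
    ... | yes _         | no ∉r         = clique-outside-root right λ j j∈r → ∉r (j , j∈r)

  data Node : Set where
    root   : Node
    clique : Side → Node
    path   : Fin p → Node
    leaf   : Fin groups → Fin q′ → Node

  opaque
    nodeCode : Node ↔ Fin (1 + (2 + (p + groups * q′)))
    nodeCode = ↔-trans asSum (↔-sym (↔-trans Fin.+↔⊎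
      (Fin.1↔⊤ ⊎-↔ ↔-trans Fin.+↔⊎ (sideCode ⊎-↔ ↔-trans Fin.+↔⊎ (↔-refl ⊎-↔ Fin.*↔×)))))
      where
      asSum : Node ↔ (⊤ ⊎ (Side ⊎ (Fin p ⊎ (Fin groups × Fin q′))))
      asSum = mk↔ₛ′
        (λ { root → inj₁ tt ; (clique s) → inj₂ (inj₁ s) ; (path i) → inj₂ (inj₂ (inj₁ i))
           ; (leaf g l) → inj₂ (inj₂ (inj₂ (g , l))) })
        (λ { (inj₁ _) → root ; (inj₂ (inj₁ s)) → clique s ; (inj₂ (inj₂ (inj₁ i))) → path i
           ; (inj₂ (inj₂ (inj₂ (g , l)))) → leaf g l })
        (λ { (inj₁ _) → refl ; (inj₂ (inj₁ _)) → refl ; (inj₂ (inj₂ (inj₁ _))) → refl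
           ; (inj₂ (inj₂ (inj₂ _))) → refl })
        (λ { root → refl ; (clique _) → refl ; (path _) → refl ; (leaf _ _) → refl })

  pathBag : Fin (suc p) → Node
  pathBag zero    = root
  pathBag (suc i) = path i

  parent : Node → Node
  parent root       = root
  parent (clique s) = pathBag (end s)
  parent (path i)   = pathBag (inject₁ i)
  parent (leaf _ _) = root

  pathBag-toRoot : ∀ k (j : Fin (suc p)) → toℕ j ≡ k → iter parent k (pathBag j) ≡ root
  pathBag-toRoot zero    zero    _  = refl
  pathBag-toRoot (suc k) (suc i) eq = trans (iter-suc parent k (path i))
    (pathBag-toRoot k (inject₁ i) (trans (Fin.toℕ-inject₁ i) (ℕ.suc-injective eq)))

  toRoot : ∀ x → ∃ λ k → iter parent k x ≡ root
  toRoot root       = 0 , refl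
  toRoot (clique s) = suc (toℕ (end s)) ,
    trans (iter-suc parent (toℕ (end s)) (clique s)) (pathBag-toRoot _ (end s) refl)
  toRoot (path i)   = toℕ (suc i) , pathBag-toRoot _ (suc i) refl
  toRoot (leaf _ _) = 1 , refl

  module Choice (f : Fin groups → Fin q) where

    leafBag : ∀ g l → Dec (f g ≡ l) → Node
    leafBag g l (yes _)    = root
    leafBag g l (no fg≢l) = leaf g (punchOut fg≢l)

    bag : Vertex → Node
    bag (clique s _) = clique s
    bag (path j)     = pathBag j
    bag (leaf g l)   = leafBag g l (f g ≟ l)

    member : Node → Vertex
    member root       = path zero
    member (clique s) = clique s zero
    member (path i)   = path (suc i)
    member (leaf g l) = leaf g (punchIn (f g) l)

    bag-member : ∀ x → bag (member x) ≡ x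
    bag-member root       = refl
    bag-member (clique s) = refl
    bag-member (path i)   = refl
    bag-member (leaf g l) with f g ≟ punchIn (f g) l
    ... | yes fg≡ = ⊥-elim (Fin.punchInᵢ≢i (f g) l (sym fg≡))
    ... | no fg≢  = cong (leaf g) (Fin.punchOut-punchIn (f g))

    arc-linked : ∀ {x y} → Arc x y → Linked root parent (bag x) (bag y)
    arc-linked (clique-clique _) = inj₁ refl
    arc-linked clique-path       = inj₂ (inj₁ ((λ ()) , refl))
    arc-linked path-path         = inj₂ (inj₂ ((λ ()) , refl))
    arc-linked (leaf-path {g} {l}) with f g ≟ l
    ... | yes _ = inj₁ refl
    ... | no _  = inj₂ (inj₁ ((λ ()) , refl))

    edges : ∀ {x y} → Adj x y → Linked root parent (bag x) (bag y)
    edges (inj₁ xy) = arc-linked xy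
    edges (inj₂ yx) = Linked-sym {parent = parent} (arc-linked yx)

    dist : ∀ x → bag x ≢ root → ∃ λ y → Adj x y × bag y ≡ parent (bag x)
    dist (clique s i)   _   = path (end s) , inj₁ clique-path , refl
    dist (path zero)    ∉r  = ⊥-elim (∉r refl)
    dist (path (suc i)) _   = path (inject₁ i) , inj₂ path-path , refl
    dist (leaf g l)     ∉r with f g ≟ l
    ... | yes _ = ⊥-elim (∉r refl)
    ... | no _  = path zero , inj₁ leaf-path , refl

    decomposition : Decomposition Node
    decomposition = record
      { root = root ; parent = parent ; toRoot = toRoot ; bag = bag
      ; member = member ; bag-member = bag-member ; edges = edges ; dist = dist }

    open Encode nodeCode decomposition public
      using (tdd; tdd-bag-root⁺; tdd-bag-root⁻; nd-injective; width≤; refines)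

    S : Subset n
    S = TDD.rootBag tdd

    chosen∈root : ∀ g → bag (leaf g (f g)) ≡ root
    chosen∈root g with f g ≟ f g
    ... | yes _   = refl
    ... | no fg≢ = ⊥-elim (fg≢ refl)

    leaf∈root⇒chosen : ∀ {g l} → bag (leaf g l) ≡ root → f g ≡ l
    leaf∈root⇒chosen {g} {l} l∈r with f g ≟ l | l∈r
    ... | yes fg≡l | _  = fg≡l
    ... | no _     | ()

    root-spoke : ∀ x → bag x ≡ root → x ≡ path zero ⊎ Adj x (path zero)
    root-spoke (path zero) _  = inj₁ refl
    root-spoke (leaf g l)  _  = inj₂ (inj₁ leaf-path)
    root-spoke (clique _ _) ()
    root-spoke (path (suc _)) ()

    S-connected : Connected graph S
    S-connected = star⇒connected graph (∈-Bag⁺ (tdd-bag-root⁺ refl)) spoke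
      where
      open TDDProperties tdd using (∈-Bag⁺; ∈-Bag⁻)
      spoke : ∀ u → u ∈ S → u ≡ vtx (path zero) ⊎ Edge graph u (vtx (path zero))
      spoke u u∈S with root-spoke (vtx⁻¹ u) (nd-injective (∈-Bag⁻ u∈S))
      ... | inj₁ u≡ = inj₁ (trans (sym (vtx∘vtx⁻¹ u)) (cong vtx u≡))
      ... | inj₂ adj =
        inj₂ (subst (λ v → Edge graph v (vtx (path zero))) (vtx∘vtx⁻¹ u) (Adj⇒Edge adj))

    members : Node → List Vertex
    members root       = path zero ∷ map (λ g → leaf g (f g)) (allFin groups)
    members (clique s) = map (clique s) (allFin w)
    members (path i)   = path (suc i) ∷ []
    members (leaf g l) = leaf g (punchIn (f g) l) ∷ []

    ∈-members : ∀ x → x ∈ₗ members (bag x)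
    ∈-members (clique s i)   = ∈-map⁺ (clique s) (∈-allFin i)
    ∈-members (path zero)    = here refl
    ∈-members (path (suc i)) = here refl
    ∈-members (leaf g l) with f g ≟ l
    ... | yes refl  = there (∈-map⁺ (λ g → leaf g (f g)) (∈-allFin g))
    ... | no fg≢l = here (cong (leaf g) (sym (Fin.punchIn-punchOut fg≢l)))

    bag≡⇒∈members : ∀ {x a} → bag x ≡ a → x ∈ₗ members a
    bag≡⇒∈members {x} refl = ∈-members x

    length-members : ∀ a → length (members a) ≤ w
    length-members root       = s≤s (ℕ.≤-reflexive (length-map-allFin (λ g → leaf g (f g))))
    length-members (clique s) = ℕ.≤-reflexive (length-map-allFin (clique s))
    length-members (path _)   = s≤s z≤n
    length-members (leaf _ _) = s≤s z≤n

    width≡ : TDD.width tdd ≡ w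
    width≡ = ℕ.≤-antisym (width≤ members ∈-members length-members)
                         (AnyDecomposition.width-lower tdd S-connected)

    module _ (D′ : TDD graph) (root≡ : TDD.rootBag D′ ≡ S) where
      open TDD D′ using () renaming (bag to bag′; root to root′)

      root-preserved : ∀ {x} → bag x ≡ root → bag′ (vtx x) ≡ root′
      root-preserved x∈r = rootBag-≡⇒∈root tdd D′ (sym root≡) (tdd-bag-root⁺ x∈r)

      clique-outside : ∀ s i → bag′ (vtx (clique s i)) ≢ root′
      clique-outside s i i∈r with tdd-bag-root⁻ (rootBag-≡⇒∈root D′ tdd root≡ i∈r)
      ... | ()

      same-bag : ∀ a {x y} → bag x ≡ a → bag y ≡ a → bag′ (vtx x) ≡ bag′ (vtx y)
      same-bag root x∈r y∈r = trans (root-preserved x∈r) (sym (root-preserved y∈r))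
      same-bag (clique s) {x} {y} x∈a y∈a
        with ∈-map⁻ (clique s) (bag≡⇒∈members {x} x∈a) | ∈-map⁻ (clique s) (bag≡⇒∈members {y} y∈a)
      ... | i , _ , refl | j , _ , refl =
        trans (clique-bag≡ s (clique-outside s) i) (sym (clique-bag≡ s (clique-outside s) j))
        where open AnyDecomposition D′ using (clique-bag≡)
      same-bag (path _) {x} {y} x∈a y∈a with bag≡⇒∈members {x} x∈a | bag≡⇒∈members {y} y∈a
      ... | here refl | here refl = refl
      same-bag (leaf _ _) {x} {y} x∈a y∈a with bag≡⇒∈members {x} x∈a | bag≡⇒∈members {y} y∈a
      ... | here refl | here refl = refl

      tdd-refines : Refines tdd D′
      tdd-refines = refines D′ (λ {x} {y} x∼y → same-bag (bag y) x∼y refl)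

    tdw≡ : TdwIs graph S w
    tdw≡ = tdd , (refl , tdd-refines) , width≡

  S-injective : ∀ {f f′} → Choice.S f ≡ Choice.S f′ → ∀ g → f g ≡ f′ g
  S-injective {f} {f′} S≡ g =
    sym (Choice.leaf∈root⇒chosen f′ (Choice.tdd-bag-root⁻ f′ {leaf g (f g)}
      (rootBag-≡⇒∈root (Choice.tdd f) (Choice.tdd f′) S≡
        (Choice.tdd-bag-root⁺ f (Choice.chosen∈root f g)))))

  rootSets : List (Subset n)
  rootSets = tabulate (Choice.S ∘ digits groups)

  rootSets-unique : Unique rootSets
  rootSets-unique = Unique.tabulate⁺ (λ S≡ → digits-injective groups (S-injective S≡))

  rootSets-tdw : All (λ S → Connected graph S × TdwIs graph S w) rootSets
  rootSets-tdw = All.tabulate⁺ λ i →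
    Choice.S-connected (digits groups i) , Choice.tdw≡ (digits groups i)

  length-rootSets : length rootSets ≡ q ^ groups
  length-rootSets = List.length-tabulate _

  ctdw≡ : CtdwIs graph w
  ctdw≡ = (tdd , S-connected , width≡) , AnyDecomposition.width-lower
    where open Choice (λ _ → zero)

double-width : ∀ t → 6 + (t + t) ≡ 2 * (3 + t)
double-width = solve-∀

vertex-count : ∀ t N → 2 * (5 + (t + t)) + (3 + (t + t) + (4 + (t + t)) * (4 + N))
                       ≡ (3 + t) + (2 + t) * (5 + 2 * (4 + N))
vertex-count = solve-∀

square-split : ∀ N → (4 + N) * (4 + N) ≡ (5 + 2 * (4 + N)) + (3 + 6 * N + N * N)
square-split = solve-∀

group-count : ∀ t → 4 + (t + t) ≡ (2 + t) + (2 + t)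
group-count = solve-∀

module Family (t N : ℕ) where
  open Construction (2 + (t + t)) (3 + N) public

  w≡ : w ≡ 2 * (3 + t) ∸ 1
  w≡ = cong (_∸ 1) (double-width t)

  N≤n : N ≤ n
  N≤n = ℕ.≤-trans (ℕ.m≤n+m N 4) (ℕ.≤-trans (ℕ.m≤m+n q _)
          (ℕ.≤-trans (ℕ.m≤n+m _ (suc (2 + (t + t)))) (ℕ.m≤n+m _ (2 * w))))

  counting : (n ∸ (3 + t)) ^ (2 + t) ≤ length rootSets * (2 + t) ^ (2 + t)
  counting = subst₂ (λ a b → a ^ (2 + t) ≤ b * (2 + t) ^ (2 + t)) (sym n∸k) (sym length≡)
    (*-^-≤-square (2 + t) (subst (5 + 2 * q ≤_) (sym (square-split N)) (ℕ.m≤m+n _ _)))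
    where
    n∸k : n ∸ (3 + t) ≡ (2 + t) * (5 + 2 * q)
    n∸k = trans (cong (_∸ (3 + t)) (vertex-count t N)) (ℕ.m+n∸m≡n (3 + t) _)

    length≡ : length rootSets ≡ q ^ ((2 + t) + (2 + t))
    length≡ = trans length-rootSets (cong (q ^_) (group-count t))

theorem4 : ∀ (k : ℕ) → 3 ≤ k → ∀ (N : ℕ) →
    ∃ λ (n : ℕ) → N ≤ n × Σ (Graph n) λ G →
      CtdwIs G (2 * k ∸ 1)
      × Σ (List (Subset n)) λ Ss →
          Unique Ss
          × All (λ S → Connected G S × TdwIs G S (2 * k ∸ 1)) Ss
          × (n ∸ k) ^ (k ∸ 1) ≤ length Ss * (k ∸ 1) ^ (k ∸ 1)
theorem4 (suc (suc (suc t))) (s≤s (s≤s (s≤s z≤n))) N =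
  n , N≤n , graph , subst (CtdwIs graph) w≡ ctdw≡ , rootSets , rootSets-unique ,
  All.map (map₂ (subst (TdwIs graph _) w≡)) rootSets-tdw , counting
  where open Family t N
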